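{- Let $A$ and $B$ be finite sets of UTVPI constraints over the rationals such that $A\wedge B$ is unsatisfiable over $\mathbb Q$, and let $A'$ and $B'$ be their difference-logic encodings. Let $I'$ be the difference-logic interpolant built from a negative-weight cycle $C$ of the constraint graph $G(A'\wedge B')$, namely $I'=\bot$ if all edges of $C$ come from $A'$, $I'=\top$ if all come from $B'$, and otherwise $I'$ is the conjunction of the summary constraints of the maximal $A'$-paths of $C$. Then $I=\Upsilon(I')$ is an interpolant for $(A,B)$.
   Context: A UTVPI constraint is an atom $(0\le a x_1 + b x_2 + k)$ with $a,b\in\{ -1,0,1\}$ and $k$ a numerical constant. For each UTVPI variable $x$ introduce two difference-logic variables $x^+$ and $x^-$, and let $\Upsilon(x^+)=x$, $\Upsilon(x^-)=-x$; for a signed variable $s=\pm x$ write $v(x)=x^+$, $v(-x)=x^-$. Encoding: a constraint $(0\le s_1+s_2+k)$ with $s_1,s_2$ signed occurrences of distinct variables is encoded as the two difference-logic constraints $(0\le v(s_1)-v(-s_2)+k)$ and $(0\le v(s_2)-v(-s_1)+k)$; a constraint $(0\le s+k)$ with one signed variable is encoded as $(0\le v(s)-v(-s)+2k)$. $\Upsilon$ extends to difference-logic constraints by $\Upsilon(0\le v-u+k) = (0\le \Upsilon(v)-\Upsilon(u)+k)$ and to conjunctions componentwise. The constraint graph has an edge $u\xrightarrow{c} v$ for each constraint $(0\le v-u+c)$, labelled as coming from $A'$ or from $B'$. A maximal $A'$-path of $C$ is a maximal path $u_1\xrightarrow{c_1}\cdots\xrightarrow{c_{n-1}}u_n$ of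 consecutive $A'$-edges of $C$ preceded and followed in $C$ by $B'$-edges; its summary constraint is $(0\le u_n-u_1+\sum_i c_i)$. An interpolant for $(A,B)$ is a formula $I$ with $A\models I$, $I\wedge B$ unsatisfiable, and every variable of $I$ occurring both in $A$ and in $B$ (over $\mathbb Q$). -}

module Defs where

open import Data.Nat using (ℕ)
open import Data.Rational using (ℚ; 0ℚ; _+_; _-_; -_; _≤_; _<_)
open import Data.Bool using (Bool; true; false; _∧_; not)
open import Data.List using (List; []; _∷_; [_]; _++_; map; concatMap; foldr)
open import Data.List.Relation.Unary.All using (All)
open import Data.List.Relation.Unary.Any using (Any)
open import Data.List.Relation.Unary.Unique.Propositional using (Unique)
open import Data.List.Membership.Propositional using (_∈_)
open import Data.Product using (_×_; _,_)
open import Data.Sum using (_⊎_)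
open import Data.Empty using (⊥)
open import Relation.Binary.PropositionalEquality using (_≡_; _≢_)

Var : Set
Var = ℕ

data Signed : Set where
  plus  : Var → Signed
  minus : Var → Signed

varOf : Signed → Var
varOf (plus x)  = x
varOf (minus x) = x

negS : Signed → Signed
negS (plus x)  = minus x
negS (minus x) = plus x

data DLVar : Set where
  _⁺ : Var → DLVar
  _⁻ : Var → DLVar

v : Signed → DLVar
v (plus x)  = x ⁺
v (minus x) = x ⁻

Υ : DLVar → Signed
Υ (x ⁺) = plus x
Υ (x ⁻) = minus x

data UTVPI : Set where
  two : (s₁ s₂ : Signed) → varOf s₁ ≢ varOf s₂ → ℚ → UTVPI
  one : Signed → ℚ → UTVPI

Assignment : Set
Assignment = Var → ℚ

⟦_⟧ₛ : Signed → Assignment → ℚ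
⟦ plus x ⟧ₛ  ρ = ρ x
⟦ minus x ⟧ₛ ρ = - ρ x

SatU : Assignment → UTVPI → Set
SatU ρ (two s₁ s₂ _ k) = 0ℚ ≤ (⟦ s₁ ⟧ₛ ρ + ⟦ s₂ ⟧ₛ ρ) + k
SatU ρ (one s k)       = 0ℚ ≤ ⟦ s ⟧ₛ ρ + k

OccursU : Var → UTVPI → Set
OccursU x (two s₁ s₂ _ _) = x ≡ varOf s₁ ⊎ x ≡ varOf s₂
OccursU x (one s _)       = x ≡ varOf s

-- Difference-logic constraints  (0 ≤ to - from + k),  i.e. edge from →k to

record DLCon : Set where
  constructor dl
  field
    from : DLVar
    to   : DLVar
    k    : ℚ
open DLCon public

encode : UTVPI → List DLCon
encode (two s₁ s₂ _ k) = dl (v (negS s₂)) (v s₁) k ∷ dl (v (negS s₁)) (v s₂) k ∷ []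
encode (one s k)       = dl (v (negS s)) (v s) (k + k) ∷ []

encodeAll : List UTVPI → List DLCon
encodeAll = concatMap encode

data Formula (Atom : Set) : Set where
  ff   : Formula Atom
  tt   : Formula Atom
  conj : List Atom → Formula Atom

record LinCon : Set where
  constructor lin
  field
    lhs : Signed
    rhs : Signed
    c   : ℚ

SatL : Assignment → LinCon → Set
SatL ρ (lin a b c) = 0ℚ ≤ (⟦ a ⟧ₛ ρ - ⟦ b ⟧ₛ ρ) + c

OccursL : Var → LinCon → Set
OccursL x (lin a b _) = x ≡ varOf a ⊎ x ≡ varOf b

SatF : Assignment → Formula LinCon → Set
SatF ρ ff        = ⊥
SatF ρ tt        = ⊤'
  where open import Data.Unit using () renaming (⊤ to ⊤')
SatF ρ (conj as) = All (SatL ρ) as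

OccursF : Var → Formula LinCon → Set
OccursF x ff        = ⊥
OccursF x tt        = ⊥
OccursF x (conj as) = Any (OccursL x) as

ΥC : DLCon → LinCon
ΥC (dl u w k) = lin (Υ w) (Υ u) k

ΥF : Formula DLCon → Formula LinCon
ΥF ff        = ff
ΥF tt        = tt
ΥF (conj as) = conj (map ΥC as)

data Side : Set where
  inA inB : Side

isA : Side → Bool
isA inA = true
isA inB = false

record Edge : Set where
  constructor edge
  field
    src  : DLVar
    tgt  : DLVar
    wt   : ℚ
    side : Side
open Edge public

toEdge : Side → DLCon → Edge
toEdge s (dl u w k) = edge u w k s

graph : List DLCon → List DLCon → List Edge
graph A' B' = map (toEdge inA) A' ++ map (toEdge inB) B'

sumℚ : List ℚ → ℚ
sumℚ = foldr _+_ 0ℚ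

weight : List Edge → ℚ
weight C = sumℚ (map wt C)

PathFrom : DLVar → List Edge → DLVar → Set
PathFrom u []       w = u ≡ w
PathFrom u (e ∷ es) w = src e ≡ u × PathFrom (tgt e) es w

Closed : List Edge → Set
Closed []       = ⊥
Closed (e ∷ es) = PathFrom (src e) (e ∷ es) (src e)

record NegCycle (G : List Edge) (C : List Edge) : Set where
  field
    edgesInG : All (_∈ G) C
    closed   : Closed C
    simple   : Unique (map src C)
    negative : weight C < 0ℚ

splitFirstB : List Edge → List Edge × List Edge
splitFirstB []       = [] , []
splitFirstB (e ∷ es) with isA (side e) | splitFirstB es
... | true  | (p , r) = (e ∷ p) , r
... | false | _       = [] , (e ∷ es)

rotate : List Edge → List Edge
rotate C with splitFirstB C
... | (p , r) = r ++ p

flush : List Edge → List (List Edge)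
flush []       = []
flush (e ∷ es) = (e ∷ es) ∷ []

aRunsGo : List Edge → List Edge → List (List Edge)
aRunsGo cur []       = flush cur
aRunsGo cur (e ∷ es) with isA (side e)
... | true  = aRunsGo (cur ++ [ e ]) es
... | false = flush cur ++ aRunsGo [] es

maximalAPaths : List Edge → List (List Edge)
maximalAPaths C = aRunsGo [] (rotate C)

lastTgt : Edge → List Edge → DLVar
lastTgt e []        = tgt e
lastTgt _ (e' ∷ es) = lastTgt e' es

summary : List Edge → List DLCon
summary []       = []
summary (e ∷ es) = dl (src e) (lastTgt e es) (weight (e ∷ es)) ∷ []

allB : (Edge → Bool) → List Edge → Bool
allB p []       = true
allB p (e ∷ es) = p e ∧ allB p es

interpolantDL : List Edge → Formula DLCon
interpolantDL C with allB (λ e → isA (side e)) C | allB (λ e → not (isA (side e))) C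
... | true  | _     = ff
... | false | true  = tt
... | false | false = conj (concatMap summary (maximalAPaths C))

Unsat : List UTVPI → List UTVPI → Set
Unsat A B = (ρ : Assignment) → All (SatU ρ) A → All (SatU ρ) B → ⊥

OccursIn : Var → List UTVPI → Set
OccursIn x A = Any (OccursU x) A

record IsInterpolant (A B : List UTVPI) (I : Formula LinCon) : Set where
  field
    entailed : (ρ : Assignment) → All (SatU ρ) A → SatF ρ I
    unsatB   : (ρ : Assignment) → SatF ρ I → All (SatU ρ) B → ⊥
    shared   : (x : Var) → OccursF x I → OccursIn x A × OccursIn x B

-- Read a rational assignment ρ as the potential  z ↦ ⟦ Υ z ⟧ ρ  on difference-logic variables.
-- Each encoded constraint, hence each edge of the constraint graph, holds for this potential
-- whenever ρ satisfies the UTVPI constraint it comes from, and the constraints along a path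
-- add up to the summary constraint of the path; a negative cycle therefore cannot be satisfied.
-- Rotate the cycle C to start with a B'-edge. Its maximal A'-paths are A'-paths, so A entails
-- their summaries; their end points lie on B'-edges and on A'-edges, so they are shared; and
-- the summaries together with the B'-edges add up to the negative weight of C, so I ∧ B is
-- unsatisfiable. The cases where C lies entirely in A' or in B' are the degenerate instances.
module Submission where

open import Defs
open import Data.Bool using (true; false; not)
open import Data.Empty using (⊥)
open import Data.List using (List; []; _∷_; [_]; _++_; map; concatMap)
open import Data.List.Properties using (++-assoc; ++-identityʳ)
open import Data.List.Membership.Propositional using (_∈_)
open import Data.List.Membership.Propositional.Properties using (∈-map⁻; ∈-++⁻)
open import Data.List.Relation.Unary.All as All using (All; []; _∷_)
import Data.List.Relation.Unary.All.Properties as AllP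
import Data.List.Relation.Unary.Any as Any
import Data.List.Relation.Unary.Any.Properties as AnyP
open import Data.List.Relation.Binary.Permutation.Propositional.Properties using (All-resp-↭; ++-comm)
open import Data.Product using (Σ-syntax; _×_; _,_; proj₁; proj₂)
open import Data.Sum using (inj₁; inj₂)
open import Data.Unit using () renaming (tt to unit)
open import Data.Rational using (0ℚ; _+_; _-_; -_; _≤_; _<_)
import Data.Rational.Properties as ℚ
open import Data.Rational.Solver using (module +-*-Solver)
open import Function using (_∘_)
open import Relation.Binary.PropositionalEquality using (_≡_; refl; sym; trans; cong; subst; module ≡-Reasoning)

open +-*-Solver

0≤+ : ∀ {a b} → 0ℚ ≤ a → 0ℚ ≤ b → 0ℚ ≤ a + b
0≤+ {a} {b} p q = subst (_≤ a + b) (ℚ.+-identityʳ 0ℚ) (ℚ.+-mono-≤ p q)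

0≤⇒≮0 : ∀ {q} → 0ℚ ≤ q → q < 0ℚ → ⊥
0≤⇒≮0 0≤q q<0 = ℚ.<-irrefl refl (ℚ.≤-<-trans 0≤q q<0)

differences-add : ∀ x y z a b → 0ℚ ≤ (y - x) + a → 0ℚ ≤ (z - y) + b → 0ℚ ≤ (z - x) + (a + b)
differences-add x y z a b p q = subst (0ℚ ≤_) eq (0≤+ p q)
  where
  eq = solve 5 (λ x y z a b → ((y :- x) :+ a) :+ ((z :- y) :+ b) := (z :- x) :+ (a :+ b)) refl x y z a b

-- A record rather than a synonym of SatL, so that the constraint d can be inferred from DLSat ρ d.
record DLSat (ρ : Assignment) (d : DLCon) : Set where
  constructor sat
  field holds : SatL ρ (ΥC d)
open DLSat

EdgeSat : Assignment → Edge → Set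
EdgeSat ρ e = DLSat ρ (dl (src e) (tgt e) (wt e))

DLSat-refl : ∀ ρ {u} → DLSat ρ (dl u u 0ℚ)
DLSat-refl ρ {u} =
  sat (subst (0ℚ ≤_) (sym (solve 1 (λ p → (p :- p) :+ con 0ℚ := con 0ℚ) refl (⟦ Υ u ⟧ₛ ρ))) ℚ.≤-refl)

DLSat-trans : ∀ {ρ u t w a b} → DLSat ρ (dl u t a) → DLSat ρ (dl t w b) → DLSat ρ (dl u w (a + b))
DLSat-trans {ρ} {u} {t} {w} {a} {b} (sat p) (sat q) =
  sat (differences-add (⟦ Υ u ⟧ₛ ρ) (⟦ Υ t ⟧ₛ ρ) (⟦ Υ w ⟧ₛ ρ) a b p q)

DLSat-loop : ∀ {ρ u c} → DLSat ρ (dl u u c) → 0ℚ ≤ c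
DLSat-loop {ρ} {u} {c} (sat p) = subst (0ℚ ≤_) (solve 2 (λ p c → (p :- p) :+ c := c) refl (⟦ Υ u ⟧ₛ ρ) c) p

DLSat-resp-weight : ∀ {ρ u w a b} → a ≡ b → DLSat ρ (dl u w a) → DLSat ρ (dl u w b)
DLSat-resp-weight refl s = s

Υ∘v : ∀ s → Υ (v s) ≡ s
Υ∘v (plus x)  = refl
Υ∘v (minus x) = refl

⟦negS⟧ : ∀ ρ s → ⟦ negS s ⟧ₛ ρ ≡ - ⟦ s ⟧ₛ ρ
⟦negS⟧ ρ (plus x)  = refl
⟦negS⟧ ρ (minus x) = sym (solve 1 (λ a → :- (:- a) := a) refl (ρ x))

⟦Υ∘v∘negS⟧ : ∀ ρ s → ⟦ Υ (v (negS s)) ⟧ₛ ρ ≡ - ⟦ s ⟧ₛ ρ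
⟦Υ∘v∘negS⟧ ρ s rewrite Υ∘v (negS s) = ⟦negS⟧ ρ s

encode-sound : ∀ ρ c → SatU ρ c → All (DLSat ρ) (encode c)
encode-sound ρ (two s₁ s₂ _ k) h = sat first ∷ sat second ∷ []
  where
  a = ⟦ s₁ ⟧ₛ ρ
  b = ⟦ s₂ ⟧ₛ ρ
  first : 0ℚ ≤ (⟦ Υ (v s₁) ⟧ₛ ρ - ⟦ Υ (v (negS s₂)) ⟧ₛ ρ) + k
  first rewrite Υ∘v s₁ | ⟦Υ∘v∘negS⟧ ρ s₂ =
    subst (0ℚ ≤_) (solve 3 (λ a b k → (a :+ b) :+ k := (a :- (:- b)) :+ k) refl a b k) h
  second : 0ℚ ≤ (⟦ Υ (v s₂) ⟧ₛ ρ - ⟦ Υ (v (negS s₁)) ⟧ₛ ρ) + k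
  second rewrite Υ∘v s₂ | ⟦Υ∘v∘negS⟧ ρ s₁ =
    subst (0ℚ ≤_) (solve 3 (λ a b k → (a :+ b) :+ k := (b :- (:- a)) :+ k) refl a b k) h
encode-sound ρ (one s k) h = sat only ∷ []
  where
  only : 0ℚ ≤ (⟦ Υ (v s) ⟧ₛ ρ - ⟦ Υ (v (negS s)) ⟧ₛ ρ) + (k + k)
  only rewrite Υ∘v s | ⟦Υ∘v∘negS⟧ ρ s =
    subst (0ℚ ≤_) (solve 2 (λ a k → (a :+ k) :+ (a :+ k) := (a :- (:- a)) :+ (k :+ k)) refl (⟦ s ⟧ₛ ρ) k)
      (0≤+ h h)

encodeAll-sound : ∀ ρ X → All (SatU ρ) X → All (DLSat ρ) (encodeAll X)
encodeAll-sound ρ X h = AllP.concat⁺ (AllP.map⁺ (All.map (encode-sound ρ _) h))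

OccursDL : DLVar → List UTVPI → Set
OccursDL z X = OccursIn (varOf (Υ z)) X

EndpointsOccur : List UTVPI → Edge → Set
EndpointsOccur X e = OccursDL (src e) X × OccursDL (tgt e) X

varOf∘Υ∘v : ∀ s → varOf (Υ (v s)) ≡ varOf s
varOf∘Υ∘v (plus x)  = refl
varOf∘Υ∘v (minus x) = refl

varOf∘Υ∘v∘negS : ∀ s → varOf (Υ (v (negS s))) ≡ varOf s
varOf∘Υ∘v∘negS (plus x)  = refl
varOf∘Υ∘v∘negS (minus x) = refl

encode-occurs : ∀ c → All (λ d → OccursU (varOf (Υ (from d))) c × OccursU (varOf (Υ (to d))) c) (encode c)
encode-occurs (two s₁ s₂ _ _) =
    (inj₂ (varOf∘Υ∘v∘negS s₂) , inj₁ (varOf∘Υ∘v s₁))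
  ∷ (inj₁ (varOf∘Υ∘v∘negS s₁) , inj₂ (varOf∘Υ∘v s₂))
  ∷ []
encode-occurs (one s _) = (varOf∘Υ∘v∘negS s , varOf∘Υ∘v s) ∷ []

encodeAll-occurs : ∀ X → All (λ d → OccursDL (from d) X × OccursDL (to d) X) (encodeAll X)
encodeAll-occurs X = AllP.concat⁺ (AllP.map⁺ (All.tabulate lift))
  where
  lift : ∀ {c} → c ∈ X → All (λ d → OccursDL (from d) X × OccursDL (to d) X) (encode c)
  lift c∈X = All.map (λ (o₁ , o₂) → occurs-in o₁ , occurs-in o₂) (encode-occurs _)
    where
    occurs-in : ∀ {x} → OccursU x _ → OccursIn x X
    occurs-in o = Any.map (λ { refl → o }) c∈X

weight-++ : ∀ xs ys → weight (xs ++ ys) ≡ weight xs + weight ys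
weight-++ []       ys = sym (ℚ.+-identityˡ (weight ys))
weight-++ (x ∷ xs) ys =
  trans (cong (wt x +_) (weight-++ xs ys)) (sym (ℚ.+-assoc (wt x) (weight xs) (weight ys)))

weight-rotate : ∀ xs ys → weight (ys ++ xs) ≡ weight (xs ++ ys)
weight-rotate xs ys = begin
  weight (ys ++ xs)        ≡⟨ weight-++ ys xs ⟩
  weight ys + weight xs    ≡⟨ ℚ.+-comm (weight ys) (weight xs) ⟩
  weight xs + weight ys    ≡⟨ weight-++ xs ys ⟨
  weight (xs ++ ys)        ∎
  where open ≡-Reasoning

path-++ : ∀ {u t w} xs ys → PathFrom u xs t → PathFrom t ys w → PathFrom u (xs ++ ys) w
path-++ []       ys refl     q = q
path-++ (x ∷ xs) ys (eq , p) q = eq , path-++ xs ys p q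

path-split : ∀ {u w} xs ys → PathFrom u (xs ++ ys) w → Σ[ t ∈ DLVar ] PathFrom u xs t × PathFrom t ys w
path-split []       ys p        = _ , refl , p
path-split (x ∷ xs) ys (eq , p) with path-split xs ys p
... | t , p₁ , p₂ = t , (eq , p₁) , p₂

closed-rotate : ∀ xs ys → Closed (xs ++ ys) → Closed (ys ++ xs)
closed-rotate []       ys       c = subst Closed (sym (++-identityʳ ys)) c
closed-rotate (x ∷ xs) []       c = subst Closed (++-identityʳ (x ∷ xs)) c
closed-rotate (x ∷ xs) (y ∷ ys) c with path-split (x ∷ xs) (y ∷ ys) c
... | _ , p₁ , (refl , p₂) = path-++ (y ∷ ys) (x ∷ xs) (refl , p₂) p₁

summary-of-path : ∀ {u w} e es → PathFrom u (e ∷ es) w → summary (e ∷ es) ≡ [ dl u w (weight (e ∷ es)) ]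
summary-of-path e es (refl , p) = cong (λ t → [ dl (src e) t (weight (e ∷ es)) ]) (lastTgt≡ e es p)
  where
  lastTgt≡ : ∀ {w} e es → PathFrom (tgt e) es w → lastTgt e es ≡ w
  lastTgt≡ e []        refl       = refl
  lastTgt≡ e (e′ ∷ es) (refl , p) = lastTgt≡ e′ es p

path-target : ∀ {Q : DLVar → Set} {u w} e es → PathFrom u (e ∷ es) w → All (Q ∘ tgt) (e ∷ es) → Q w
path-target e []        (_ , refl) (q ∷ []) = q
path-target e (e′ ∷ es) (_ , p)    (_ ∷ qs) = path-target e′ es p qs

path-sound : ∀ ρ {u w} es → PathFrom u es w → All (EdgeSat ρ) es → DLSat ρ (dl u w (weight es))
path-sound ρ []       refl       []       = DLSat-refl ρ
path-sound ρ (e ∷ es) (refl , p) (s ∷ ss) = DLSat-trans s (path-sound ρ es p ss)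

closed-nonneg : ∀ ρ C → Closed C → All (EdgeSat ρ) C → 0ℚ ≤ weight C
closed-nonneg ρ (e ∷ es) c h = DLSat-loop (path-sound ρ (e ∷ es) c h)

negative-cycle-unsat : ∀ ρ {C} → Closed C → weight C < 0ℚ → All (EdgeSat ρ) C → ⊥
negative-cycle-unsat ρ {C} c neg h = 0≤⇒≮0 (closed-nonneg ρ C c h) neg

SummariesSat : Assignment → List (List Edge) → Set
SummariesSat ρ = All (All (DLSat ρ) ∘ summary)

flush-sat : ∀ ρ cur {u w} → PathFrom u cur w → SummariesSat ρ (flush cur) → DLSat ρ (dl u w (weight cur))
flush-sat ρ []       refl _ = DLSat-refl ρ
flush-sat ρ (c ∷ cs) p (h ∷ []) = All.head (subst (All (DLSat ρ)) (summary-of-path c cs p) h)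

-- cur is the A'-run under construction, from u₀ to u; es is the rest of the cycle, from u to w.
runs-and-B-edges-sat : ∀ ρ cur es {u₀ u w} → PathFrom u₀ cur u → PathFrom u es w →
                       All (λ e → side e ≡ inB → EdgeSat ρ e) es → SummariesSat ρ (aRunsGo cur es) →
                       DLSat ρ (dl u₀ w (weight (cur ++ es)))
runs-and-B-edges-sat ρ cur [] p refl [] h =
  DLSat-resp-weight (cong weight (sym (++-identityʳ cur))) (flush-sat ρ cur p h)
runs-and-B-edges-sat ρ cur (e@(edge _ _ x inB) ∷ es) p (refl , q) (s ∷ ss) h
  with AllP.++⁻ (flush cur) h
... | h-cur , h-rest =
  DLSat-resp-weight weight≡
    (DLSat-trans
      (DLSat-trans (flush-sat ρ cur p h-cur) (s refl))
      (runs-and-B-edges-sat ρ [] es refl q ss h-rest))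
  where
  weight≡ : (weight cur + x) + weight es ≡ weight (cur ++ e ∷ es)
  weight≡ = trans (ℚ.+-assoc (weight cur) x (weight es)) (sym (weight-++ cur (e ∷ es)))
runs-and-B-edges-sat ρ cur (e@(edge _ _ _ inA) ∷ es) p (refl , q) (_ ∷ ss) h =
  DLSat-resp-weight (cong weight (++-assoc cur [ e ] es))
    (runs-and-B-edges-sat ρ (cur ++ [ e ]) es (path-++ cur [ e ] p (refl , refl)) q ss h)

all-onA : ∀ C → allB (λ e → isA (side e)) C ≡ true → All (λ e → side e ≡ inA) C
all-onA []                    _ = []
all-onA (edge _ _ _ inA ∷ es) h = refl ∷ all-onA es h

all-onB : ∀ C → allB (λ e → not (isA (side e))) C ≡ true → All (λ e → side e ≡ inB) C
all-onB []                    _ = []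
all-onB (edge _ _ _ inB ∷ es) h = refl ∷ all-onB es h

splitFirstB-found : ∀ C → allB (λ e → isA (side e)) C ≡ false →
                    Σ[ p ∈ List Edge ] Σ[ e ∈ Edge ] Σ[ r ∈ List Edge ]
                      splitFirstB C ≡ (p , e ∷ r) × C ≡ p ++ e ∷ r × side e ≡ inB
splitFirstB-found (e@(edge _ _ _ inB) ∷ es) _ = [] , e , es , refl , refl , refl
splitFirstB-found (e@(edge _ _ _ inA) ∷ es) h with splitFirstB-found es h
... | p , b , r , split≡ , es≡ , onB rewrite split≡ = e ∷ p , b , r , refl , cong (e ∷_) es≡ , onB

data Shape (C : List Edge) : Set where
  onlyA : All (λ e → side e ≡ inA) C → interpolantDL C ≡ ff → Shape C
  onlyB : All (λ e → side e ≡ inB) C → interpolantDL C ≡ tt → Shape C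
  mixed : ∀ p e r → C ≡ p ++ e ∷ r → side e ≡ inB →
          interpolantDL C ≡ conj (concatMap summary (aRunsGo [] (e ∷ r ++ p))) → Shape C

shape : ∀ C → Shape C
shape C with allB (λ e → isA (side e)) C in hA | allB (λ e → not (isA (side e))) C in hB
... | true  | _    = onlyA (all-onA C hA) interpolant≡
  where
  interpolant≡ : interpolantDL C ≡ ff
  interpolant≡ rewrite hA = refl
... | false | true = onlyB (all-onB C hB) interpolant≡
  where
  interpolant≡ : interpolantDL C ≡ tt
  interpolant≡ rewrite hA | hB = refl
... | false | false with splitFirstB-found C hA
...   | p , e , r , split≡ , C≡ , onB = mixed p e r C≡ onB interpolant≡
  where
  interpolant≡ : interpolantDL C ≡ conj (concatMap summary (aRunsGo [] (e ∷ r ++ p)))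
  interpolant≡ rewrite hA | hB | split≡ = refl

module Interpolation (A B : List UTVPI) where

  constraintsOn : Side → List UTVPI
  constraintsOn inA = A
  constraintsOn inB = B

  edgesOn : Side → List Edge
  edgesOn s = map (toEdge s) (encodeAll (constraintsOn s))

  G : List Edge
  G = graph (encodeAll A) (encodeAll B)

  edgesOn-side : ∀ {s e} → e ∈ edgesOn s → side e ≡ s
  edgesOn-side m with ∈-map⁻ (toEdge _) m
  ... | _ , _ , refl = refl

  ∈G⇒∈edgesOn : ∀ {e} → e ∈ G → e ∈ edgesOn (side e)
  ∈G⇒∈edgesOn {e} m with ∈-++⁻ (edgesOn inA) m
  ... | inj₁ m′ = subst (λ s → e ∈ edgesOn s) (sym (edgesOn-side m′)) m′
  ... | inj₂ m′ = subst (λ s → e ∈ edgesOn s) (sym (edgesOn-side m′)) m′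

  edgesOn-sat : ∀ ρ s → All (SatU ρ) (constraintsOn s) → All (EdgeSat ρ) (edgesOn s)
  edgesOn-sat ρ s h = AllP.map⁺ (encodeAll-sound ρ (constraintsOn s) h)

  edge-sat : ∀ ρ {s e} → All (SatU ρ) (constraintsOn s) → e ∈ G → side e ≡ s → EdgeSat ρ e
  edge-sat ρ h m refl = All.lookup (edgesOn-sat ρ _ h) (∈G⇒∈edgesOn m)

  edgesOn-occurs : ∀ s → All (EndpointsOccur (constraintsOn s)) (edgesOn s)
  edgesOn-occurs s = AllP.map⁺ (encodeAll-occurs (constraintsOn s))

  edge-occurs : ∀ {e} → e ∈ G → EndpointsOccur (constraintsOn (side e)) e
  edge-occurs m = All.lookup (edgesOn-occurs _) (∈G⇒∈edgesOn m)

  Shared : DLVar → Set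
  Shared z = OccursDL z A × OccursDL z B

  record SoundSummary (d : DLCon) : Set where
    field
      from-shared : Shared (from d)
      to-shared   : Shared (to d)
      entailed    : ∀ ρ → All (SatU ρ) A → DLSat ρ d
  open SoundSummary

  flush-SoundSummary : ∀ cur {u w} → PathFrom u cur w → All (_∈ edgesOn inA) cur →
                       OccursDL u B → OccursDL w B → All (All SoundSummary ∘ summary) (flush cur)
  flush-SoundSummary []       _            _   _  _  = []
  flush-SoundSummary (c ∷ cs) p@(refl , _) onA bu bw =
    subst (All SoundSummary) (sym (summary-of-path c cs p)) (sound ∷ []) ∷ []
    where
    occurs : All (EndpointsOccur A) (c ∷ cs)
    occurs = All.map (All.lookup (edgesOn-occurs inA)) onA
    sound : SoundSummary (dl (src c) _ (weight (c ∷ cs)))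
    sound = record
      { from-shared = proj₁ (All.head occurs) , bu
      ; to-shared   = path-target c cs p (All.map proj₂ occurs) , bw
      ; entailed    = λ ρ h → path-sound ρ (c ∷ cs) p (All.map (All.lookup (edgesOn-sat ρ inA h)) onA)
      }

  runs-SoundSummary : ∀ cur es {u₀ u w} → PathFrom u₀ cur u → PathFrom u es w →
                      All (_∈ edgesOn inA) cur → OccursDL u₀ B → All (_∈ G) es → OccursDL w B →
                      All (All SoundSummary ∘ summary) (aRunsGo cur es)
  runs-SoundSummary cur [] p refl onA b₀ [] bw = flush-SoundSummary cur p onA b₀ bw
  runs-SoundSummary cur (edge _ _ _ inB ∷ es) p (refl , q) onA b₀ (m ∷ ms) bw =
    AllP.++⁺ (flush-SoundSummary cur p onA b₀ (proj₁ (edge-occurs m)))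
             (runs-SoundSummary [] es refl q [] (proj₂ (edge-occurs m)) ms bw)
  runs-SoundSummary cur (e@(edge _ _ _ inA) ∷ es) p (refl , q) onA b₀ (m ∷ ms) bw =
    runs-SoundSummary (cur ++ [ e ]) es (path-++ cur [ e ] p (refl , refl)) q
                      (AllP.++⁺ onA (∈G⇒∈edgesOn m ∷ [])) b₀ ms bw

  shared-variable : ∀ {x d} → SoundSummary d → OccursL x (ΥC d) → OccursIn x A × OccursIn x B
  shared-variable s (inj₁ refl) = to-shared s
  shared-variable s (inj₂ refl) = from-shared s

  ff-interpolant : ∀ {C} → Closed C → weight C < 0ℚ → All (_∈ G) C → All (λ e → side e ≡ inA) C →
                   IsInterpolant A B ff
  ff-interpolant c neg inG onA = record
    { entailed = λ ρ h →
        negative-cycle-unsat ρ c neg (All.zipWith (λ (m , s) → edge-sat ρ h m s) (inG , onA))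
    ; unsatB   = λ _ ()
    ; shared   = λ _ ()
    }

  tt-interpolant : ∀ {C} → Closed C → weight C < 0ℚ → All (_∈ G) C → All (λ e → side e ≡ inB) C →
                   IsInterpolant A B tt
  tt-interpolant c neg inG onB = record
    { entailed = λ _ _ → unit
    ; unsatB   = λ ρ _ h →
        negative-cycle-unsat ρ c neg (All.zipWith (λ (m , s) → edge-sat ρ h m s) (inG , onB))
    ; shared   = λ _ ()
    }

  summaries-interpolant : ∀ e es → side e ≡ inB → Closed (e ∷ es) → weight (e ∷ es) < 0ℚ →
                          All (_∈ G) (e ∷ es) → IsInterpolant A B (ΥF (conj (concatMap summary (aRunsGo [] (e ∷ es)))))
  summaries-interpolant e es onB c neg inG = record
    { entailed = λ ρ h → AllP.map⁺ (All.map (λ s → holds (entailed s ρ h)) sounds)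
    ; unsatB   = λ ρ hI hB → 0≤⇒≮0 (DLSat-loop
                   (runs-and-B-edges-sat ρ [] (e ∷ es) refl c (All.map (edge-sat ρ hB) inG)
                     (AllP.map⁻ (AllP.concat⁻ (All.map sat (AllP.map⁻ hI)))))) neg
    ; shared   = λ x o → let s , occ = All.lookupAny sounds (AnyP.map⁻ o) in shared-variable s occ
    }
    where
    src-in-B : OccursDL (src e) B
    src-in-B = subst (λ s → OccursDL (src e) (constraintsOn s)) onB (proj₁ (edge-occurs (All.head inG)))
    sounds : All SoundSummary (concatMap summary (aRunsGo [] (e ∷ es)))
    sounds = AllP.concat⁺ (AllP.map⁺ (runs-SoundSummary [] (e ∷ es) refl c [] src-in-B inG src-in-B))

  negCycle-interpolant : ∀ {C} → NegCycle G C → Shape C → IsInterpolant A B (ΥF (interpolantDL C))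
  negCycle-interpolant nc (onlyA onA eq) rewrite eq = ff-interpolant closed negative edgesInG onA
    where open NegCycle nc
  negCycle-interpolant nc (onlyB onB eq) rewrite eq = tt-interpolant closed negative edgesInG onB
    where open NegCycle nc
  negCycle-interpolant nc (mixed p e r refl onB eq) rewrite eq =
    summaries-interpolant e (r ++ p) onB (closed-rotate p (e ∷ r) closed)
      (subst (_< 0ℚ) (sym (weight-rotate p (e ∷ r))) negative) (All-resp-↭ (++-comm p (e ∷ r)) edgesInG)
    where open NegCycle nc

mainTheorem7 : (A B : List UTVPI) → Unsat A B → (C : List Edge) → NegCycle (graph (encodeAll A) (encodeAll B)) C → IsInterpolant A B (ΥF (interpolantDL C))
mainTheorem7 A B _ C nc = Interpolation.negCycle-interpolant A B nc (shape C)
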